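{- Let $G$ be a $2$-connected, non-bipartite graph with a $k$-separation $(G_0,G_1)$, $k\in\{2,3\}$, $G_1$ bipartite, let $H$ be a gadget attachable to $G_1$, set $G_1':=G_1\cup H$, and let $c:E(G_1)\to\mathbb{R}_{\ge0}$. If $F\subseteq E(H)$ is feasible and $F$ is the disjoint union of $A$ and $B$, then $\gamma(F)\le\gamma(A)+\gamma(B)$.
   Context: A $k$-separation of $G$ is an ordered pair $(G_0,G_1)$ of edge-disjoint subgraphs with $G=G_0\cup G_1$, $|V(G_0)\cap V(G_1)|=k$, and $E(G_0)$, $E(G_1)$, $V(G_1)\setminus V(G_0)$, $V(G_0)\setminus V(G_1)$ nonempty. A gadget is a graph isomorphic to $P_3$ (path on 3 nodes), $P_4$ (path on 4 nodes), $S_{2,2,2}$ (center joined to three leaves by internally disjoint paths with 2,2,2 edges) or $S_{2,3,3}$ (paths with 2,3,3 edges); $H$ is attachable to $G_1$ if its leaf set equals $V(G_0)\cap V(G_1)$, its non-leaf nodes are disjoint from $V(G)$, and $G_1\cup H$ is bipartite. For a stable set $S$, an edge is slack if neither end is in $S$, and $\sigma(S)$ is the set of slack edges. For $F\subseteq E(H)$, $\gamma(F):=\min\{c(\sigma(S)\cap E(G_1))\mid S\text{ stable set of } G_1',\ \sigma(S)\cap E(H)=F\}\in\mathbb{R}_{\ge0}\cup\{\infty\}$ (with $\min\emptyset=\infty$), and $F$ is feasible if $\gamma(F)<\infty$.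
   Formalization: The edge costs $c$ are nonnegative rationals instead of nonnegative reals. -}

module Defs where

open import Data.Nat using (ℕ; zero; suc; _≡ᵇ_; _<ᵇ_; _≤_)
import Data.Nat as N
open import Data.Fin using (Fin; zero; suc; toℕ)
open import Data.Bool using (Bool; true; false; _∧_; _∨_; not; if_then_else_; T)
open import Data.Bool.Properties using (T-∨)
open import Data.Unit using (tt)
open import Function.Bundles using (Equivalence)
open import Data.List using (List; []; _∷_)
open import Data.Bool.ListAction using (any)
open import Data.Product using (Σ; ∃; _×_; _,_)
open import Data.Sum using (_⊎_; inj₁; inj₂)
open import Data.Empty using (⊥)
open import Relation.Nullary using (¬_)
open import Relation.Binary.PropositionalEquality using (_≡_; _≢_; refl; cong₂; subst; sym)
open import Data.Rational using (ℚ; 0ℚ; _+_)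
import Data.Rational as Q

-- Finite simple graphs inside an ambient vertex universe Fin n.
-- A graph is a vertex set V ⊆ Fin n and a symmetric, irreflexive
-- adjacency relation E whose edges have both ends in V.

VSet : ℕ → Set
VSet n = Fin n → Bool

ESet : ℕ → Set
ESet n = Fin n → Fin n → Bool

record Graph (n : ℕ) : Set where
  field
    V     : VSet n
    E     : ESet n
    E-sym : ∀ i j → E i j ≡ E j i
    E-irr : ∀ i → E i i ≡ false
    E-V   : ∀ i j → T (E i j) → T (V i)
open Graph public

Σℕ : ∀ {m} → (Fin m → ℕ) → ℕ
Σℕ {zero}  f = 0
Σℕ {suc m} f = f zero N.+ Σℕ (λ i → f (suc i))

count : ∀ {m} → (Fin m → Bool) → ℕ
count p = Σℕ (λ i → if p i then 1 else 0)

Σℚ : ∀ {m} → (Fin m → ℚ) → ℚ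
Σℚ {zero}  f = 0ℚ
Σℚ {suc m} f = f zero + Σℚ (λ i → f (suc i))

_∪G_ : ∀ {n} → Graph n → Graph n → Graph n
G ∪G H = record
  { V = λ i → V G i ∨ V H i
  ; E = λ i j → E G i j ∨ E H i j
  ; E-sym = λ i j → cong₂ _∨_ (E-sym G i j) (E-sym H i j)
  ; E-irr = irr
  ; E-V = ev
  }
  where
  irr : ∀ i → (E G i i ∨ E H i i) ≡ false
  irr i with E G i i | E-irr G i | E H i i | E-irr H i
  ... | false | refl | false | refl = refl
  ev : ∀ i j → T (E G i j ∨ E H i j) → T (V G i ∨ V H i)
  ev i j p with E G i j in eg
  ... | true  = Equivalence.from T-∨ (inj₁ (E-V G i j (subst T (sym eg) tt)))
  ... | false = Equivalence.from T-∨ (inj₂ (E-V H i j p))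

data Reach {n} (W : VSet n) (E : ESet n) (u : Fin n) : Fin n → Set where
  here : T (W u) → Reach W E u u
  step : ∀ {w v} → Reach W E u w → T (E w v) → T (W v) → Reach W E u v

ConnectedOn : ∀ {n} → VSet n → ESet n → Set
ConnectedOn W E = ∀ u v → T (W u) → T (W v) → Reach W E u v

TwoConnected : ∀ {n} → Graph n → Set
TwoConnected G =
  (3 ≤ count (V G)) ×
  ConnectedOn (V G) (E G) ×
  (∀ x → T (V G x) →
     ConnectedOn (λ i → V G i ∧ not (⌊ i ≟F x ⌋)) (E G))
  where
  open import Data.Fin using () renaming (_≟_ to _≟F_)
  open import Relation.Nullary.Decidable using (⌊_⌋)

Bipartite : ∀ {n} → Graph n → Set
Bipartite {n} G = Σ (Fin n → Bool) λ col → ∀ i j → T (E G i j) → col i ≢ col j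

IsSeparation : ∀ {n} → ℕ → Graph n → Graph n → Graph n → Set
IsSeparation {n} k G G₀ G₁ =
  (∀ i → V G i ≡ (V G₀ i ∨ V G₁ i)) ×
  (∀ i j → E G i j ≡ (E G₀ i j ∨ E G₁ i j)) ×
  (∀ i j → (E G₀ i j ∧ E G₁ i j) ≡ false) ×
  (count (λ i → V G₀ i ∧ V G₁ i) ≡ k) ×
  (Σ (Fin n) λ i → Σ (Fin n) λ j → T (E G₀ i j)) ×
  (Σ (Fin n) λ i → Σ (Fin n) λ j → T (E G₁ i j)) ×
  (Σ (Fin n) λ i → T (V G₁ i ∧ not (V G₀ i))) ×
  (Σ (Fin n) λ i → T (V G₀ i ∧ not (V G₁ i)))

adjFrom : ∀ {m} → List (ℕ × ℕ) → Fin m → Fin m → Bool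
adjFrom es a b = any (λ { (x , y) → ((toℕ a ≡ᵇ x) ∧ (toℕ b ≡ᵇ y)) ∨ ((toℕ a ≡ᵇ y) ∧ (toℕ b ≡ᵇ x)) }) es

-- the model gadgets (vertex 0 is the centre of S_{a,b,c})
P₃ : ESet 3
P₃ = adjFrom ((0 , 1) ∷ (1 , 2) ∷ [])

P₄ : ESet 4
P₄ = adjFrom ((0 , 1) ∷ (1 , 2) ∷ (2 , 3) ∷ [])

S₂₂₂ : ESet 7
S₂₂₂ = adjFrom ((0 , 1) ∷ (1 , 2) ∷ (0 , 3) ∷ (3 , 4) ∷ (0 , 5) ∷ (5 , 6) ∷ [])

S₂₃₃ : ESet 9
S₂₃₃ = adjFrom ((0 , 1) ∷ (1 , 2) ∷ (0 , 3) ∷ (3 , 4) ∷ (4 , 5) ∷ (0 , 6) ∷ (6 , 7) ∷ (7 , 8) ∷ [])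

IsoTo : ∀ {n} → Graph n → (m : ℕ) → ESet m → Set
IsoTo {n} H m M =
  Σ (Fin m → Fin n) λ φ →
    (∀ a b → φ a ≡ φ b → a ≡ b) ×
    (∀ i → T (V H i) → ∃ λ a → φ a ≡ i) ×
    (∀ a → T (V H (φ a))) ×
    (∀ a b → E H (φ a) (φ b) ≡ M a b)

Gadget : ∀ {n} → Graph n → Set
Gadget H = IsoTo H 3 P₃ ⊎ IsoTo H 4 P₄ ⊎ IsoTo H 7 S₂₂₂ ⊎ IsoTo H 9 S₂₃₃

degree : ∀ {n} → Graph n → Fin n → ℕ
degree H i = count (E H i)

isLeaf : ∀ {n} → Graph n → Fin n → Bool
isLeaf H i = V H i ∧ (degree H i ≡ᵇ 1)

Attachable : ∀ {n} → Graph n → Graph n → Graph n → Graph n → Set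
Attachable G G₀ G₁ H =
  (∀ i → isLeaf H i ≡ (V G₀ i ∧ V G₁ i)) ×
  (∀ i → T (V H i ∧ not (isLeaf H i)) → V G i ≡ false) ×
  Bipartite (G₁ ∪G H)

Stable : ∀ {n} → Graph n → VSet n → Set
Stable G S = (∀ i → T (S i) → T (V G i)) × (∀ i j → T (E G i j) → T (S i ∧ S j) → ⊥)

slackIn : ∀ {n} → ESet n → VSet n → ESet n
slackIn E S i j = E i j ∧ not (S i) ∧ not (S j)

SlackOnH≡ : ∀ {n} → Graph n → VSet n → ESet n → Set
SlackOnH≡ H S F = ∀ i j → slackIn (E H) S i j ≡ F i j

-- c(σ(S) ∩ E(G₁)), summing each edge {i,j} once (i < j)
slackCost : ∀ {n} → Graph n → (Fin n → Fin n → ℚ) → VSet n → ℚ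
slackCost G₁ c S = Σℚ λ i → Σℚ λ j →
  if (toℕ i <ᵇ toℕ j) ∧ slackIn (E G₁) S i j then c i j else 0ℚ

Realizes : ∀ {n} → Graph n → Graph n → VSet n → ESet n → Set
Realizes G₁ H S F = Stable (G₁ ∪G H) S × SlackOnH≡ H S F

Feasible : ∀ {n} → Graph n → Graph n → ESet n → Set
Feasible G₁ H F = ∃ λ S → Realizes G₁ H S F

-- γ(F) ≤ γ(A) + γ(B)  (minima over finitely many stable sets, ∞ = min ∅):
-- for every stable set realizing A and every one realizing B there is one
-- realizing F whose cost is at most the sum of their costs.
γ≤γ+γ : ∀ {n} → Graph n → Graph n → (Fin n → Fin n → ℚ) → ESet n → ESet n → ESet n → Set
γ≤γ+γ G₁ H c F A B =
  ∀ Sa Sb → Realizes G₁ H Sa A → Realizes G₁ H Sb B →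
    ∃ λ S → Realizes G₁ H S F ×
      (slackCost G₁ c S Q.≤ (slackCost G₁ c Sa + slackCost G₁ c Sb))

SubEdges : ∀ {n} → ESet n → Graph n → Set
SubEdges F H = (∀ i j → F i j ≡ F j i) × (∀ i j → T (F i j) → T (E H i j))

{-# OPTIONS --safe #-}

-- Fix a proper 2-colouring col of G₁ ∪ H and stable sets Sa, Sb, Sf realising A, B, F.  Let S
-- be Sa ∩ Sb on one colour class and Sa ∪ Sb on the other.  S is stable and every edge slack for
-- S is slack for Sa or for Sb, so c(σ(S)) ≤ c(σ(Sa)) + c(σ(Sb)) as c ≥ 0.  The class receiving
-- the intersection is chosen so that σ(S) ∩ E(H) = F: across an edge, the potential col ⊕ X of a
-- stable set X flips exactly when the edge is slack for X, so, as F = A ⊎ B, the exchange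
-- potential (col ⊕ Sa) ⊕ (col ⊕ Sb) ⊕ (col ⊕ Sf) is constant, say g, on the connected gadget H.
-- Putting the intersection where col ⊕ g holds makes S = Sa ∩ Sb at every vertex of H outside
-- Sf, and then an edge of H is slack for S exactly when it lies in A ∪ B = F.

module Submission where

open import Defs
open import Data.Nat using (ℕ; suc; _<ᵇ_)
open import Data.Fin using (Fin; zero; suc; toℕ; #_)
open import Data.Bool using (Bool; true; false; not; _∨_; _∧_; _xor_; if_then_else_; T)
open import Data.Bool.Properties
  using (∧-comm; ¬-not; not-involutive; not-distribˡ-xor; not-distribʳ-xor;
         xor-annihilates-not; xor-identityʳ; xor-∧-commutativeRing; T-≡; T-∧; T-∨)
open import Data.Sum using (_⊎_; inj₁; inj₂)
open import Data.Product using (∃; ∃-syntax; _×_; _,_; proj₁; proj₂)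
open import Data.Unit using (tt)
open import Function using (_∘_)
open import Function.Bundles using (Equivalence)
open import Relation.Nullary using (¬_; contradiction)
open import Relation.Binary.PropositionalEquality
  using (_≡_; _≢_; refl; sym; trans; cong; cong₂; subst; ≢-sym; module ≡-Reasoning)
open import Data.Rational using (ℚ; 0ℚ; _≤_; _+_)
import Data.Rational.Properties as ℚ
open import Algebra.Bundles using (CommutativeMonoid; CommutativeRing; AbelianGroup)
open import Algebra.Properties.CommutativeSemigroup
  (CommutativeMonoid.commutativeSemigroup ℚ.+-0-commutativeMonoid) using (interchange)
open import Algebra.Properties.Group
  (AbelianGroup.group (CommutativeRing.+-abelianGroup xor-∧-commutativeRing))
  using () renaming (∙-cancelʳ to xor-cancelʳ)

open Equivalence using (to; from)

T-ext : ∀ {x y} → (T x → T y) → (T y → T x) → x ≡ y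
T-ext {false} {false} _   _   = refl
T-ext {false} {true}  _   y⇒x = contradiction tt y⇒x
T-ext {true}  {false} x⇒y _   = contradiction tt x⇒y
T-ext {true}  {true}  _   _   = refl

slack : Bool → Bool → Bool
slack x y = not x ∧ not y

slack-comm : ∀ x y → slack x y ≡ slack y x
slack-comm x y = ∧-comm (not x) (not y)

slack⇒false : ∀ {x y} → T (slack x y) → x ≡ false × y ≡ false
slack⇒false {false} {false} _ = refl , refl
slack⇒false {false} {true}  ()
slack⇒false {true}          ()

slack-antitone : ∀ {x y x′ y′} → T (slack x y) → (T x′ → T x) → (T y′ → T y) →
                 T (slack x′ y′)
slack-antitone {false} {false} {false} {false} _ _      _      = tt
slack-antitone {false} {false} {false} {true}  _ _      y′⇒y = y′⇒y tt
slack-antitone {false} {false} {true}          _ x′⇒x _      = x′⇒x tt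
slack-antitone {false} {true}                  ()
slack-antitone {true}                          ()

slack-∧ : ∀ a a′ b b′ → T (slack a a′ ∨ slack b b′) → T (slack (a ∧ b) (a′ ∧ b′))
slack-∧ a a′ b b′ h with to (T-∨ {slack a a′}) h
... | inj₁ slack-a =
  slack-antitone {a} {a′} {a ∧ b} {a′ ∧ b′} slack-a (proj₁ ∘ to T-∧) (proj₁ ∘ to T-∧)
... | inj₂ slack-b =
  slack-antitone {b} {b′} {a ∧ b} {a′ ∧ b′} slack-b (proj₂ ∘ to T-∧) (proj₂ ∘ to T-∧)

meetOrJoin : Bool → Bool → Bool → Bool
meetOrJoin true  a b = a ∧ b
meetOrJoin false a b = a ∨ b

meetOrJoin⇒∨ : ∀ s a b → T (meetOrJoin s a b) → T (a ∨ b)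
meetOrJoin⇒∨ true  true  _ _ = tt
meetOrJoin⇒∨ true  false _ ()
meetOrJoin⇒∨ false _     _ h = h

meetOrJoin-xor : ∀ a b → meetOrJoin (a xor b) a b ≡ a ∧ b
meetOrJoin-xor true  true  = refl
meetOrJoin-xor true  false = refl
meetOrJoin-xor false true  = refl
meetOrJoin-xor false false = refl

independent-∧∨ : ∀ a a′ b b′ → ¬ T (a ∧ a′) → ¬ T (b ∧ b′) → ¬ T ((a ∧ b) ∧ (a′ ∨ b′))
independent-∧∨ true  true  true  _     ¬aa′ _    _  = ¬aa′ tt
independent-∧∨ true  false true  true  _    ¬bb′ _  = ¬bb′ tt
independent-∧∨ true  false true  false _    _    ()
independent-∧∨ true  _     false _     _    _    ()
independent-∧∨ false _     _     _     _    _    ()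

slack-∧∨ : ∀ a a′ b b′ → T (slack (a ∧ b) (a′ ∨ b′)) → T (slack a a′ ∨ slack b b′)
slack-∧∨ true  _     true  _     ()
slack-∧∨ true  true  false _     ()
slack-∧∨ true  false false true  ()
slack-∧∨ true  false false false _ = tt
slack-∧∨ false true  _     _     ()
slack-∧∨ false false _     true  ()
slack-∧∨ false false _     false _ = tt

SlackCovered : ∀ {n} → ESet n → VSet n → VSet n → VSet n → Set
SlackCovered E S Sa Sb =
  ∀ i j → T (E i j) → T (slack (S i) (S j)) → T (slack (Sa i) (Sa j) ∨ slack (Sb i) (Sb j))

meetJoin : ∀ {n} → (Fin n → Bool) → VSet n → VSet n → VSet n
meetJoin side Sa Sb i = meetOrJoin (side i) (Sa i) (Sb i)

module _ {n} (K : Graph n) (side : Fin n → Bool)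
         (proper : ∀ i j → T (E K i j) → side i ≢ side j) where

  edge-sym : ∀ {i j} → T (E K i j) → T (E K j i)
  edge-sym {i} {j} = subst T (E-sym K i j)

  meet-side-wlog : (P : Fin n → Fin n → Set) → (∀ {i j} → P i j → P j i) →
                   (∀ i j → T (E K i j) → side i ≡ true → side j ≡ false → P i j) →
                   ∀ i j → T (E K i j) → P i j
  meet-side-wlog P P-sym P-meet i j e with side i in si | side j in sj
  ... | true  | false = P-meet i j e si sj
  ... | false | true  = P-sym (P-meet j i (edge-sym e) sj si)
  ... | true  | true  = contradiction (trans si (sym sj)) (proper i j e)
  ... | false | false = contradiction (trans si (sym sj)) (proper i j e)

  module _ {Sa Sb : VSet n} (Sa-stable : Stable K Sa) (Sb-stable : Stable K Sb) where

    meetJoin-stable : Stable K (meetJoin side Sa Sb)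
    meetJoin-stable = in-V , independent
      where
      S : VSet n
      S = meetJoin side Sa Sb

      in-V : ∀ i → T (S i) → T (V K i)
      in-V i Si with to T-∨ (meetOrJoin⇒∨ (side i) (Sa i) (Sb i) Si)
      ... | inj₁ Sai = proj₁ Sa-stable i Sai
      ... | inj₂ Sbi = proj₁ Sb-stable i Sbi

      at-meet : ∀ i j → T (E K i j) → side i ≡ true → side j ≡ false →
                ¬ T (meetOrJoin (side i) (Sa i) (Sb i) ∧ meetOrJoin (side j) (Sa j) (Sb j))
      at-meet i j e si sj rewrite si | sj =
        independent-∧∨ (Sa i) (Sa j) (Sb i) (Sb j) (proj₂ Sa-stable i j e) (proj₂ Sb-stable i j e)

      independent : ∀ i j → T (E K i j) → ¬ T (S i ∧ S j)
      independent = meet-side-wlog (λ i j → ¬ T (S i ∧ S j))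
                                   (λ {i} {j} h → h ∘ subst T (∧-comm (S j) (S i)))
                                   at-meet

    meetJoin-slack : SlackCovered (E K) (meetJoin side Sa Sb) Sa Sb
    meetJoin-slack = meet-side-wlog P P-sym at-meet
      where
      S : VSet n
      S = meetJoin side Sa Sb

      P : Fin n → Fin n → Set
      P i j = T (slack (S i) (S j)) → T (slack (Sa i) (Sa j) ∨ slack (Sb i) (Sb j))

      P-sym : ∀ {i j} → P i j → P j i
      P-sym {i} {j} h = subst T (cong₂ _∨_ (slack-comm (Sa i) (Sa j)) (slack-comm (Sb i) (Sb j)))
                      ∘ h ∘ subst T (slack-comm (S j) (S i))

      at-meet : ∀ i j → T (E K i j) → side i ≡ true → side j ≡ false →
                T (slack (meetOrJoin (side i) (Sa i) (Sb i)) (meetOrJoin (side j) (Sa j) (Sb j))) →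
                T (slack (Sa i) (Sa j) ∨ slack (Sb i) (Sb j))
      at-meet i j _ si sj rewrite si | sj = slack-∧∨ (Sa i) (Sa j) (Sb i) (Sb j)

0≤+ : ∀ {p q} → 0ℚ ≤ p → 0ℚ ≤ q → 0ℚ ≤ p + q
0≤+ p≥0 q≥0 =
  ℚ.≤-trans (ℚ.≤-reflexive (sym (ℚ.+-identityʳ 0ℚ))) (ℚ.+-mono-≤ p≥0 q≥0)

Σℚ-subadditive : ∀ {m} (f g h : Fin m → ℚ) → (∀ i → f i ≤ g i + h i) →
                 Σℚ f ≤ Σℚ g + Σℚ h
Σℚ-subadditive {ℕ.zero}  _ _ _ _       = 0≤+ ℚ.≤-refl ℚ.≤-refl
Σℚ-subadditive {ℕ.suc m} f g h f≤g+h =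
  ℚ.≤-trans (ℚ.+-mono-≤ (f≤g+h zero)
                        (Σℚ-subadditive (f ∘ suc) (g ∘ suc) (h ∘ suc) (f≤g+h ∘ suc)))
            (ℚ.≤-reflexive (interchange (g zero) (h zero) (Σℚ (g ∘ suc)) (Σℚ (h ∘ suc))))

if-nonneg : ∀ y {c : ℚ} → 0ℚ ≤ c → 0ℚ ≤ (if y then c else 0ℚ)
if-nonneg true  c≥0 = c≥0
if-nonneg false _   = ℚ.≤-refl

if-subadditive : ∀ x y z {c : ℚ} → 0ℚ ≤ c → (T x → T (y ∨ z)) →
                 (if x then c else 0ℚ) ≤ (if y then c else 0ℚ) + (if z then c else 0ℚ)
if-subadditive false y     z     c≥0 _   = 0≤+ (if-nonneg y c≥0) (if-nonneg z c≥0)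
if-subadditive true  true  z {c} c≥0 _   =
  ℚ.≤-trans (ℚ.≤-reflexive (sym (ℚ.+-identityʳ c))) (ℚ.+-monoʳ-≤ c (if-nonneg z c≥0))
if-subadditive true  false true  {c} _ _ = ℚ.≤-reflexive (sym (ℚ.+-identityˡ c))
if-subadditive true  false false _   x⇒ = contradiction tt x⇒

slack-term-subadditive :
  ∀ p e {s sa sb} {c : ℚ} → (T e → 0ℚ ≤ c) → (T e → T s → T (sa ∨ sb)) →
  (if p ∧ (e ∧ s) then c else 0ℚ) ≤
  (if p ∧ (e ∧ sa) then c else 0ℚ) + (if p ∧ (e ∧ sb) then c else 0ℚ)
slack-term-subadditive true  true  {s} {sa} {sb} c≥0 s⇒ =
  if-subadditive s sa sb (c≥0 tt) (s⇒ tt)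
slack-term-subadditive true  false _   _  = 0≤+ ℚ.≤-refl ℚ.≤-refl
slack-term-subadditive false _     _   _  = 0≤+ ℚ.≤-refl ℚ.≤-refl

slackCost-subadditive : ∀ {n} (G₁ : Graph n) (c : Fin n → Fin n → ℚ) →
  (∀ i j → T (E G₁ i j) → 0ℚ ≤ c i j) → {S Sa Sb : VSet n} → SlackCovered (E G₁) S Sa Sb →
  slackCost G₁ c S ≤ slackCost G₁ c Sa + slackCost G₁ c Sb
slackCost-subadditive G₁ c c≥0 {S} {Sa} {Sb} slack⊆ =
  Σℚ-subadditive (Σℚ ∘ term S) (Σℚ ∘ term Sa) (Σℚ ∘ term Sb) λ i →
  Σℚ-subadditive (term S i) (term Sa i) (term Sb i) λ j →
  slack-term-subadditive (toℕ i <ᵇ toℕ j) (E G₁ i j)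
    {slack (S i) (S j)} {slack (Sa i) (Sa j)} {slack (Sb i) (Sb j)} (c≥0 i j) (slack⊆ i j)
  where
  term : VSet _ → Fin _ → Fin _ → ℚ
  term X i j = if (toℕ i <ᵇ toℕ j) ∧ slackIn (E G₁) X i j then c i j else 0ℚ

Connected : ∀ {n} → Graph n → Set₁
Connected {n} H = ∀ {A : Set} (f : Fin n → A) → (∀ i j → T (E H i j) → f i ≡ f j) →
                  ∃[ a ] ∀ i → T (V H i) → f i ≡ a

JoinedTo0 : ∀ {m} → ESet (suc m) → Set₁
JoinedTo0 {m} M = ∀ {A : Set} (f : Fin (suc m) → A) → (∀ a b → T (M a b) → f a ≡ f b) →
                  ∀ a → f a ≡ f zero

P₃-joinedTo0 : JoinedTo0 P₃
P₃-joinedTo0 f edge = λ where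
  zero             → refl
  (suc zero)       → edge (# 1) (# 0) tt
  (suc (suc zero)) → trans (edge (# 2) (# 1) tt) (edge (# 1) (# 0) tt)

P₄-joinedTo0 : JoinedTo0 P₄
P₄-joinedTo0 f edge = λ where
  zero                   → refl
  (suc zero)             → edge (# 1) (# 0) tt
  (suc (suc zero))       → trans (edge (# 2) (# 1) tt) (edge (# 1) (# 0) tt)
  (suc (suc (suc zero))) →
    trans (edge (# 3) (# 2) tt) (trans (edge (# 2) (# 1) tt) (edge (# 1) (# 0) tt))

S₂₂₂-joinedTo0 : JoinedTo0 S₂₂₂
S₂₂₂-joinedTo0 f edge = λ where
  zero                                     → refl
  (suc zero)                               → edge (# 1) (# 0) tt
  (suc (suc zero))                         → trans (edge (# 2) (# 1) tt) (edge (# 1) (# 0) tt)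
  (suc (suc (suc zero)))                   → edge (# 3) (# 0) tt
  (suc (suc (suc (suc zero))))             → trans (edge (# 4) (# 3) tt) (edge (# 3) (# 0) tt)
  (suc (suc (suc (suc (suc zero)))))       → edge (# 5) (# 0) tt
  (suc (suc (suc (suc (suc (suc zero)))))) → trans (edge (# 6) (# 5) tt) (edge (# 5) (# 0) tt)

S₂₃₃-joinedTo0 : JoinedTo0 S₂₃₃
S₂₃₃-joinedTo0 f edge = λ where
  zero                         → refl
  (suc zero)                   → edge (# 1) (# 0) tt
  (suc (suc zero))             → trans (edge (# 2) (# 1) tt) (edge (# 1) (# 0) tt)
  (suc (suc (suc zero)))       → edge (# 3) (# 0) tt
  (suc (suc (suc (suc zero)))) → trans (edge (# 4) (# 3) tt) (edge (# 3) (# 0) tt)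
  (suc (suc (suc (suc (suc zero))))) →
    trans (edge (# 5) (# 4) tt) (trans (edge (# 4) (# 3) tt) (edge (# 3) (# 0) tt))
  (suc (suc (suc (suc (suc (suc zero)))))) →
    edge (# 6) (# 0) tt
  (suc (suc (suc (suc (suc (suc (suc zero))))))) →
    trans (edge (# 7) (# 6) tt) (edge (# 6) (# 0) tt)
  (suc (suc (suc (suc (suc (suc (suc (suc zero)))))))) →
    trans (edge (# 8) (# 7) tt) (trans (edge (# 7) (# 6) tt) (edge (# 6) (# 0) tt))

iso-connected : ∀ {n m} {H : Graph n} {M : ESet (suc m)} →
                IsoTo H (suc m) M → JoinedTo0 M → Connected H
iso-connected (φ , _ , onto , _ , φ-edges) M-joined f f-const =
  f (φ zero) , λ i i∈H → along (onto i i∈H)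
  where
  along : ∀ {i} → ∃ (λ a → φ a ≡ i) → f i ≡ f (φ zero)
  along (a , refl) =
    M-joined (f ∘ φ) (λ a b Mab → f-const (φ a) (φ b) (subst T (sym (φ-edges a b)) Mab)) a

gadget-connected : ∀ {n} {H : Graph n} → Gadget H → Connected H
gadget-connected {H = H} (inj₁ iso)               = iso-connected {H = H} iso P₃-joinedTo0
gadget-connected {H = H} (inj₂ (inj₁ iso))        = iso-connected {H = H} iso P₄-joinedTo0
gadget-connected {H = H} (inj₂ (inj₂ (inj₁ iso))) = iso-connected {H = H} iso S₂₂₂-joinedTo0
gadget-connected {H = H} (inj₂ (inj₂ (inj₂ iso))) = iso-connected {H = H} iso S₂₃₃-joinedTo0

Independent : ∀ {n} → ESet n → VSet n → Set
Independent E S = ∀ i j → T (E i j) → ¬ T (S i ∧ S j)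

potential : ∀ {n} → (Fin n → Bool) → VSet n → Fin n → Bool
potential col S i = col i xor S i

exchangePotential : ∀ {n} → (Fin n → Bool) → VSet n → VSet n → VSet n → Fin n → Bool
exchangePotential col Sa Sb Sf i = potential col Sa i xor (potential col Sb i xor potential col Sf i)

xor-even-copies : ∀ c x y z → c xor ((c xor x) xor ((c xor y) xor (c xor z))) ≡ x xor (y xor z)
xor-even-copies false x y z = refl
xor-even-copies true  x y z = begin
  not (not x xor (not y xor not z)) ≡⟨ cong (λ w → not (not x xor w)) (xor-annihilates-not y z) ⟩
  not (not x xor (y xor z))         ≡⟨ cong not (sym (not-distribˡ-xor x (y xor z))) ⟩
  not (not (x xor (y xor z)))       ≡⟨ not-involutive _ ⟩
  x xor (y xor z)                   ∎
  where open ≡-Reasoning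

potential-step : ∀ c x y → ¬ T (x ∧ y) → not c xor y ≡ slack x y xor (c xor x)
potential-step _     true  true  ¬xy = contradiction tt ¬xy
potential-step true  false false _   = refl
potential-step true  true  false _   = refl
potential-step true  false true  _   = refl
potential-step false false false _   = refl
potential-step false true  false _   = refl
potential-step false false true  _   = refl

xor-flip : ∀ sa sb x y z → ¬ T (sa ∧ sb) →
           (sa xor x) xor ((sb xor y) xor ((sa ∨ sb) xor z)) ≡ x xor (y xor z)
xor-flip true  true  _ _ _ ¬ab = contradiction tt ¬ab
xor-flip true  false x y z _   = trans (cong (not x xor_) (sym (not-distribʳ-xor y z)))
                                       (xor-annihilates-not x (y xor z))
xor-flip false true  x y z _   = cong (x xor_) (xor-annihilates-not y z)
xor-flip false false _ _ _ _   = refl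

exchangePotential-edge :
  ∀ {n} (E : ESet n) (col : Fin n → Bool) {Sa Sb Sf : VSet n} →
  (∀ i j → T (E i j) → col i ≢ col j) →
  Independent E Sa → Independent E Sb → Independent E Sf →
  (∀ i j → T (E i j) → slack (Sf i) (Sf j) ≡ slack (Sa i) (Sa j) ∨ slack (Sb i) (Sb j)) →
  (∀ i j → T (E i j) → ¬ T (slack (Sa i) (Sa j) ∧ slack (Sb i) (Sb j))) →
  ∀ i j → T (E i j) → exchangePotential col Sa Sb Sf i ≡ exchangePotential col Sa Sb Sf j
exchangePotential-edge E col {Sa} {Sb} {Sf} proper Sa-ind Sb-ind Sf-ind split disjoint i j e =
  sym (begin
  ρ Sa j xor (ρ Sb j xor ρ Sf j)
    ≡⟨ cong₂ _xor_ (across Sa Sa-ind) (cong₂ _xor_ (across Sb Sb-ind) (across Sf Sf-ind)) ⟩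
  (sa xor ρ Sa i) xor ((sb xor ρ Sb i) xor (slack (Sf i) (Sf j) xor ρ Sf i))
    ≡⟨ cong (λ sf → (sa xor ρ Sa i) xor ((sb xor ρ Sb i) xor (sf xor ρ Sf i))) (split i j e) ⟩
  (sa xor ρ Sa i) xor ((sb xor ρ Sb i) xor ((sa ∨ sb) xor ρ Sf i))
    ≡⟨ xor-flip sa sb (ρ Sa i) (ρ Sb i) (ρ Sf i) (disjoint i j e) ⟩
  ρ Sa i xor (ρ Sb i xor ρ Sf i)
    ∎)
  where
  open ≡-Reasoning

  ρ : VSet _ → Fin _ → Bool
  ρ = potential col

  sa sb : Bool
  sa = slack (Sa i) (Sa j)
  sb = slack (Sb i) (Sb j)

  across : ∀ S → Independent E S → ρ S j ≡ slack (S i) (S j) xor ρ S i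
  across S S-ind = trans (cong (_xor S j) (¬-not (≢-sym (proper i j e))))
                         (potential-step (col i) (S i) (S j) (S-ind i j e))

∪G-edgeˡ : ∀ {n} (G H : Graph n) {i j} → T (E G i j) → T (E (G ∪G H) i j)
∪G-edgeˡ G _ {i} {j} e = from (T-∨ {E G i j}) (inj₁ e)

∪G-edgeʳ : ∀ {n} (G H : Graph n) {i j} → T (E H i j) → T (E (G ∪G H) i j)
∪G-edgeʳ G _ {i} {j} e = from (T-∨ {E G i j}) (inj₂ e)

slackOnH≡-edge : ∀ {n} (H : Graph n) (S : VSet n) {F} → SlackOnH≡ H S F →
                 ∀ {i j} → T (E H i j) → slack (S i) (S j) ≡ F i j
slackOnH≡-edge H S {F} S-slack {i} {j} e =
  subst (λ h → h ∧ slack (S i) (S j) ≡ F i j) (to T-≡ e) (S-slack i j)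

slackOnH≡-intro : ∀ {n} (H : Graph n) (S : VSet n) {F} →
                  (∀ i j → T (F i j) → T (E H i j)) →
                  (∀ i j → T (E H i j) → slack (S i) (S j) ≡ F i j) → SlackOnH≡ H S F
slackOnH≡-intro H _ F⊆H on-edges i j with E H i j in eq
... | true  = on-edges i j (from T-≡ eq)
... | false = T-ext (λ ()) (subst T eq ∘ F⊆H i j)

module Exchange
  {n} (G₁ H : Graph n) (H-connected : Connected H)
  (col : Fin n → Bool) (proper : ∀ i j → T (E (G₁ ∪G H) i j) → col i ≢ col j)
  {F A B : ESet n} (F⊆H : ∀ i j → T (F i j) → T (E H i j))
  (F≡A∨B : ∀ i j → F i j ≡ (A i j ∨ B i j))
  (A∧B≡∅ : ∀ i j → (A i j ∧ B i j) ≡ false)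
  {Sf Sa Sb : VSet n} (Sf-realizes : Realizes G₁ H Sf F)
  (Sa-realizes : Realizes G₁ H Sa A) (Sb-realizes : Realizes G₁ H Sb B)
  where

  K : Graph n
  K = G₁ ∪G H

  H-edge : ∀ {i j} → T (E H i j) → T (E K i j)
  H-edge = ∪G-edgeʳ G₁ H

  H-independent : ∀ {S X} → Realizes G₁ H S X → Independent (E H) S
  H-independent (S-stable , _) i j e = proj₂ S-stable i j (H-edge e)

  slack-on-H : ∀ S {X} → Realizes G₁ H S X → ∀ {i j} → T (E H i j) → slack (S i) (S j) ≡ X i j
  slack-on-H S (_ , S-slack) = slackOnH≡-edge H S S-slack

  slack-split : ∀ i j → T (E H i j) →
                slack (Sf i) (Sf j) ≡ slack (Sa i) (Sa j) ∨ slack (Sb i) (Sb j)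
  slack-split i j e = begin
    slack (Sf i) (Sf j)                       ≡⟨ slack-on-H Sf Sf-realizes e ⟩
    F i j                                     ≡⟨ F≡A∨B i j ⟩
    A i j ∨ B i j                             ≡⟨ sym (cong₂ _∨_ (slack-on-H Sa Sa-realizes e)
                                                                (slack-on-H Sb Sb-realizes e)) ⟩
    slack (Sa i) (Sa j) ∨ slack (Sb i) (Sb j) ∎
    where open ≡-Reasoning

  slack-disjoint : ∀ i j → T (E H i j) → ¬ T (slack (Sa i) (Sa j) ∧ slack (Sb i) (Sb j))
  slack-disjoint i j e =
    subst T (trans (cong₂ _∧_ (slack-on-H Sa Sa-realizes e) (slack-on-H Sb Sb-realizes e))
                   (A∧B≡∅ i j))

  γ : Fin n → Bool
  γ = exchangePotential col Sa Sb Sf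

  γ-constant : ∃[ g ] ∀ v → T (V H v) → γ v ≡ g
  γ-constant = H-connected γ
    (exchangePotential-edge (E H) col (λ i j → proper i j ∘ H-edge)
       (H-independent Sa-realizes) (H-independent Sb-realizes) (H-independent Sf-realizes)
       slack-split slack-disjoint)

  g : Bool
  g = proj₁ γ-constant

  side : Fin n → Bool
  side v = col v xor g

  side-proper : ∀ i j → T (E K i j) → side i ≢ side j
  side-proper i j e = proper i j e ∘ xor-cancelʳ g (col i) (col j)

  S : VSet n
  S = meetJoin side Sa Sb

  S-slack : SlackCovered (E K) S Sa Sb
  S-slack = meetJoin-slack K side side-proper (proj₁ Sa-realizes) (proj₁ Sb-realizes)

  -- This is what the choice of g buys: off Sf, the side of a vertex of H is Sa ⊕ Sb there.
  S-meet : ∀ v → T (V H v) → Sf v ≡ false → S v ≡ Sa v ∧ Sb v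
  S-meet v v∈H Sf-v = begin
    meetOrJoin (col v xor g) (Sa v) (Sb v)   ≡⟨ cong (λ s → meetOrJoin s (Sa v) (Sb v)) side≡ ⟩
    meetOrJoin (Sa v xor Sb v) (Sa v) (Sb v) ≡⟨ meetOrJoin-xor (Sa v) (Sb v) ⟩
    Sa v ∧ Sb v                              ∎
    where
    open ≡-Reasoning

    side≡ : col v xor g ≡ Sa v xor Sb v
    side≡ = begin
      col v xor g               ≡⟨ cong (col v xor_) (sym (proj₂ γ-constant v v∈H)) ⟩
      col v xor γ v             ≡⟨ xor-even-copies (col v) (Sa v) (Sb v) (Sf v) ⟩
      Sa v xor (Sb v xor Sf v)  ≡⟨ cong (λ f → Sa v xor (Sb v xor f)) Sf-v ⟩
      Sa v xor (Sb v xor false) ≡⟨ cong (Sa v xor_) (xor-identityʳ (Sb v)) ⟩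
      Sa v xor Sb v             ∎

  S-slack-on-H : ∀ i j → T (E H i j) → slack (S i) (S j) ≡ F i j
  S-slack-on-H i j e = T-ext (subst T slack-a∨b≡F ∘ S-slack i j (H-edge e)) F⇒slack
    where
    slack-f≡F : slack (Sf i) (Sf j) ≡ F i j
    slack-f≡F = slack-on-H Sf Sf-realizes e

    slack-a∨b≡F : slack (Sa i) (Sa j) ∨ slack (Sb i) (Sb j) ≡ F i j
    slack-a∨b≡F = trans (sym (slack-split i j e)) slack-f≡F

    F⇒slack : T (F i j) → T (slack (S i) (S j))
    F⇒slack Fij with slack⇒false (subst T (sym slack-f≡F) Fij)
    ... | Sf-i , Sf-j =
      subst T (sym (cong₂ slack (S-meet i (E-V H i j e) Sf-i)
                                (S-meet j (E-V H j i (subst T (E-sym H i j) e)) Sf-j)))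
            (slack-∧ (Sa i) (Sa j) (Sb i) (Sb j) (subst T (sym slack-a∨b≡F) Fij))

  exchange : ∃[ S ] Realizes G₁ H S F × SlackCovered (E G₁) S Sa Sb
  exchange = S
           , (meetJoin-stable K side side-proper (proj₁ Sa-realizes) (proj₁ Sb-realizes)
             , slackOnH≡-intro H S F⊆H S-slack-on-H)
           , λ i j → S-slack i j ∘ ∪G-edgeˡ G₁ H

lemma13 : ∀ {n} (k : ℕ) (G G₀ G₁ H : Graph n) (c : Fin n → Fin n → ℚ)
            (F A B : ESet n) →
            TwoConnected G → ¬ Bipartite G →
            IsSeparation k G G₀ G₁ → (k ≡ 2 ⊎ k ≡ 3) →
            Bipartite G₁ →
            Gadget H → Attachable G G₀ G₁ H →
            (∀ i j → T (E G₁ i j) → 0ℚ ≤ c i j) →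
            SubEdges F H → SubEdges A H → SubEdges B H → Feasible G₁ H F →
            (∀ i j → F i j ≡ (A i j ∨ B i j)) →
            (∀ i j → (A i j ∧ B i j) ≡ false) →
            γ≤γ+γ G₁ H c F A B
lemma13 _ _ _ G₁ H c F A B _ _ _ _ _ gadget (_ , _ , col , proper) c≥0 (_ , F⊆H) _ _
        (_ , Sf-realizes) F≡A∨B A∧B≡∅ Sa Sb Sa-realizes Sb-realizes =
  let S , S-realizes , slack⊆ =
        Exchange.exchange G₁ H (gadget-connected {H = H} gadget) col proper F⊆H F≡A∨B A∧B≡∅
                          Sf-realizes Sa-realizes Sb-realizes
  in  S , S-realizes , slackCost-subadditive G₁ c c≥0 {S} {Sa} {Sb} slack⊆
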